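{- Let $\mathrm{H}$ be a reflexive tournament containing a subtournament $\mathrm{H}_0$ such that every endomorphism $e$ of $\mathrm{H}$ with $e(V(\mathrm{H}_0))=V(\mathrm{H}_0)$ is an automorphism. Then every endomorphism of $\mathrm{H}$ whose restriction to $\mathrm{H}_0$ is an isomorphism onto an induced subgraph $\mathrm{H}'_0$ of $\mathrm{H}$ is an automorphism of $\mathrm{H}$.
   Context: A reflexive tournament is a digraph with more than one vertex, a loop at every vertex, and exactly one of $(u,v),(v,u)$ as an edge for every two distinct vertices; a subtournament is an induced subgraph that is a tournament. An endomorphism is a homomorphism (edge-preserving vertex map) from a digraph to itself; an automorphism is a bijective endomorphism whose inverse is a homomorphism. -}

module Defs where

open import Data.Nat using (ℕ; _≤_)
open import Data.Fin using (Fin)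
open import Data.Fin.Subset using (Subset; _∈_; ∣_∣)
open import Data.Product using (Σ; _×_; ∃)
open import Data.Sum using (_⊎_)
open import Relation.Nullary using (¬_)
open import Relation.Binary.PropositionalEquality using (_≡_; _≢_)
open import Level using (0ℓ; suc)

Digraph : ℕ → Set₁
Digraph n = Fin n → Fin n → Set

record IsReflexiveTournament {n : ℕ} (E : Digraph n) : Set where
  field
    moreThanOne : 2 ≤ n
    loop        : ∀ v → E v v
    total       : ∀ u v → u ≢ v → E u v ⊎ E v u
    antisym     : ∀ u v → u ≢ v → E u v → ¬ E v u

-- The induced subgraph on S is a tournament (the loops and the
-- tournament condition are inherited from the ambient tournament),
-- so the only extra requirement is having more than one vertex.
IsSubtournament : {n : ℕ} → Digraph n → Subset n → Set
IsSubtournament {n} E S = 2 ≤ ∣ S ∣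

IsEndomorphism : {n : ℕ} → Digraph n → (Fin n → Fin n) → Set
IsEndomorphism E e = ∀ u v → E u v → E (e u) (e v)

IsAutomorphism : {n : ℕ} → Digraph n → (Fin n → Fin n) → Set
IsAutomorphism E e =
  IsEndomorphism E e ×
  Σ (Fin _ → Fin _) λ g →
    (∀ v → g (e v) ≡ v) × (∀ v → e (g v) ≡ v) × IsEndomorphism E g

MapsOnto : {n : ℕ} → (Fin n → Fin n) → Subset n → Set
MapsOnto e S =
  (∀ v → v ∈ S → e v ∈ S) × (∀ w → w ∈ S → ∃ λ v → v ∈ S × e v ≡ w)

-- The restriction of e to the induced subgraph on S is an isomorphism
-- onto the induced subgraph on its image e(S): injective on S, and
-- edges are preserved and reflected between vertices of S.
RestrictionIsIsoOntoImage : {n : ℕ} → Digraph n → (Fin n → Fin n) → Subset n → Set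
RestrictionIsIsoOntoImage E e S =
  (∀ u v → u ∈ S → v ∈ S → e u ≡ e v → u ≡ v) ×
  (∀ u v → u ∈ S → v ∈ S → E (e u) (e v) → E u v)

module Submission where

open import Defs
open import Data.Nat using (ℕ; suc)
open import Data.Nat.Properties using (1+n≰n)
open import Data.Fin using (Fin; _≟_; punchOut)
open import Data.Fin.Properties using (any?; punchOut-injective; injective⇒≤)
open import Data.Fin.Subset using (Subset; _∈_)
open import Data.Fin.Subset.Properties using (_∈?_)
open import Data.Product using (_×_; _,_; ∃)
open import Data.Sum using (inj₁; inj₂)
open import Function using (_∘_)
open import Function.Definitions using (Injective)
open import Relation.Nullary using (Dec; yes; no; contradiction)
open import Relation.Nullary.Decidable using (_×-dec_)
open import Relation.Binary.PropositionalEquality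

-- Let r send each vertex f v to a preimage under f, chosen in
-- H₀ whenever possible. Then e = r ∘ f fixes H₀ pointwise and satisfies
-- f ∘ e = f, and in a tournament this makes e an endomorphism. By hypothesis
-- e is an automorphism, so it is injective, hence so is f. An injective
-- self-map of a finite set is a bijection, and in a reflexive tournament
-- the inverse of a bijective endomorphism is again an endomorphism.

injective⇒surjective : ∀ {n} {f : Fin n → Fin n} → Injective _≡_ _≡_ f →
                       ∀ w → ∃ λ v → f v ≡ w
injective⇒surjective {suc m} {f} f-inj w with any? (λ v → f v ≟ w)
... | yes hit = hit
... | no miss = contradiction (injective⇒≤ h-inj) 1+n≰n
  where
  -- If w were missed, punching it out would inject Fin (suc m) into Fin m.
  w≢f : ∀ v → w ≢ f v
  w≢f v w≡fv = miss (v , sym w≡fv)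

  h : Fin (suc m) → Fin m
  h v = punchOut (w≢f v)

  h-inj : Injective _≡_ _≡_ h
  h-inj {x} {y} = f-inj ∘ punchOut-injective (w≢f x) (w≢f y)

module _ {n : ℕ} {E : Digraph n} (T : IsReflexiveTournament E)
         {f : Fin n → Fin n} (f-hom : IsEndomorphism E f) where

  open IsReflexiveTournament T

  reflects-edge : ∀ x y → E (f x) (f y) → (f x ≡ f y → x ≡ y) → E x y
  reflects-edge x y fx→fy fx≡fy⇒x≡y with x ≟ y
  ... | yes refl = loop x
  ... | no x≢y with total x y x≢y
  ...   | inj₁ x→y = x→y
  ...   | inj₂ y→x = contradiction (f-hom y x y→x)
                       (antisym (f x) (f y) (x≢y ∘ fx≡fy⇒x≡y) fx→fy)

  retraction-endomorphism : (r : Fin n → Fin n) → (∀ v → f (r (f v)) ≡ f v) →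
                            IsEndomorphism E (r ∘ f)
  retraction-endomorphism r f∘r∘f≗f u v u→v =
    reflects-edge (r (f u)) (r (f v))
      (subst₂ E (sym (f∘r∘f≗f u)) (sym (f∘r∘f≗f v)) (f-hom u v u→v))
      (λ eq → cong r (trans (sym (f∘r∘f≗f u)) (trans eq (f∘r∘f≗f v))))

  inverse-endomorphism : Injective _≡_ _≡_ f → (g : Fin n → Fin n) →
                         (∀ v → f (g v) ≡ v) → IsEndomorphism E g
  inverse-endomorphism f-inj g f∘g≗id u v u→v =
    reflects-edge (g u) (g v)
      (subst₂ E (sym (f∘g≗id u)) (sym (f∘g≗id v)) u→v) f-inj

  injective⇒automorphism : Injective _≡_ _≡_ f → IsAutomorphism E f
  injective⇒automorphism f-inj =
    f-hom , g , (λ v → f-inj (f∘g≗id (f v))) , f∘g≗id ,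
    inverse-endomorphism f-inj g f∘g≗id
    where
    g : Fin n → Fin n
    g w = let (v , _) = injective⇒surjective f-inj w in v

    f∘g≗id : ∀ w → f (g w) ≡ w
    f∘g≗id w = let (_ , fv≡w) = injective⇒surjective f-inj w in fv≡w

automorphism-injective : ∀ {n} {E : Digraph n} {e : Fin n → Fin n} →
                         IsAutomorphism E e → Injective _≡_ _≡_ e
automorphism-injective (_ , g , g∘e≗id , _) {x} {y} ex≡ey =
  trans (sym (g∘e≗id x)) (trans (cong g ex≡ey) (g∘e≗id y))

fixes-pointwise⇒MapsOnto : ∀ {n} {e : Fin n → Fin n} {S : Subset n} →
                           (∀ s → s ∈ S → e s ≡ s) → MapsOnto e S
fixes-pointwise⇒MapsOnto {S = S} fix =
  (λ s s∈S → subst (_∈ S) (sym (fix s s∈S)) s∈S) ,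
  (λ s s∈S → s , s∈S , fix s s∈S)

module _ {n : ℕ} (f : Fin n → Fin n) (S : Subset n) where

  private
    preimage-in? : ∀ z → Dec (∃ λ w → w ∈ S × f w ≡ z)
    preimage-in? z = any? (λ w → (w ∈? S) ×-dec (f w ≟ z))

    preimage? : ∀ z → Dec (∃ λ w → f w ≡ z)
    preimage? z = any? (λ w → f w ≟ z)

    choose : ∀ z → Dec (∃ λ w → w ∈ S × f w ≡ z) → Dec (∃ λ w → f w ≡ z) → Fin n
    choose z (yes (w , _)) _            = w
    choose z (no _)        (yes (w , _)) = w
    choose z (no _)        (no _)        = z

    choose-preimage : ∀ v d d′ → f (choose (f v) d d′) ≡ f v
    choose-preimage v (yes (_ , _ , fw≡fv)) _ = fw≡fv
    choose-preimage v (no _) (yes (_ , fw≡fv)) = fw≡fv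
    choose-preimage v (no _) (no none) = contradiction (v , refl) none

    choose-in : (∀ u v → u ∈ S → v ∈ S → f u ≡ f v → u ≡ v) →
                ∀ s → s ∈ S → ∀ d d′ → choose (f s) d d′ ≡ s
    choose-in injS s s∈S (yes (w , w∈S , fw≡fs)) _ = injS w s w∈S s∈S fw≡fs
    choose-in injS s s∈S (no none) _ = contradiction (s , s∈S , refl) none

  preimage-preferring : Fin n → Fin n
  preimage-preferring z = choose z (preimage-in? z) (preimage? z)

  preimage-preferring-preimage : ∀ v → f (preimage-preferring (f v)) ≡ f v
  preimage-preferring-preimage v = choose-preimage v (preimage-in? (f v)) (preimage? (f v))

  preimage-preferring-in : (∀ u v → u ∈ S → v ∈ S → f u ≡ f v → u ≡ v) →
                           ∀ s → s ∈ S → preimage-preferring (f s) ≡ s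
  preimage-preferring-in injS s s∈S = choose-in injS s s∈S (preimage-in? (f s)) (preimage? (f s))

lemma17 : (n : ℕ) (E : Digraph n) → IsReflexiveTournament E →
    (S : Subset n) → IsSubtournament E S →
    (∀ (e : Fin n → Fin n) → IsEndomorphism E e → MapsOnto e S → IsAutomorphism E e) →
    ∀ (f : Fin n → Fin n) → IsEndomorphism E f → RestrictionIsIsoOntoImage E f S →
    IsAutomorphism E f
lemma17 n E T S _ onto⇒aut f f-hom (injS , _) =
  injective⇒automorphism T f-hom f-inj
  where
  r : Fin n → Fin n
  r = preimage-preferring f S

  e-aut : IsAutomorphism E (r ∘ f)
  e-aut = onto⇒aut (r ∘ f)
    (retraction-endomorphism T f-hom r (preimage-preferring-preimage f S))
    (fixes-pointwise⇒MapsOnto (preimage-preferring-in f S injS))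

  f-inj : Injective _≡_ _≡_ f
  f-inj = automorphism-injective e-aut ∘ cong r
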